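{- Let $t\ge 1$ be an integer, let $S_t$ be the star with $t$ edges, and let $\mathcal{F}$ be a finite family of graphs. Then $\mathrm{ex}(n,S_t,\mathcal{F})$ is either $\Theta(1)$, $\Theta(n)$, or $\Omega(n^t)$ (as $n\to\infty$).
   Context: $\mathrm{ex}(n,H,\mathcal{F})$ denotes the maximum number of copies of $H$ in an $n$-vertex graph containing no copy (as a subgraph) of any member of $\mathcal{F}$. -}

module Defs where

open import Data.Bool using (Bool; true; false; _∧_; _∨_; not; if_then_else_)
open import Data.Nat using (ℕ; zero; suc; _+_; _*_; _^_; _≤_)
open import Data.Nat.DivMod using (_/_)
open import Data.Fin using (Fin; zero; suc)
open import Data.Fin.Properties using () renaming (_≟_ to _≟ᶠ_)
open import Data.List using (List; []; _∷_; map; concatMap; filter; length; allFin)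
open import Data.Vec using (Vec; []; _∷_; lookup)
open import Data.Product using (Σ; _×_; ∃-syntax; proj₁; proj₂)
open import Data.List.Membership.Propositional using (_∈_)
open import Relation.Nullary.Decidable using (⌊_⌋)
open import Relation.Binary.PropositionalEquality using (_≡_)

record Graph (n : ℕ) : Set where
  field
    adj    : Fin n → Fin n → Bool
    sym    : ∀ i j → adj i j ≡ adj j i
    irrefl : ∀ i → adj i i ≡ false
open Graph public

allMaps : (k n : ℕ) → List (Vec (Fin n) k)
allMaps zero    n = [] ∷ []
allMaps (suc k) n = concatMap (λ i → map (i ∷_) (allMaps k n)) (allFin n)

eqᶠ : ∀ {n} → Fin n → Fin n → Bool
eqᶠ i j = ⌊ i ≟ᶠ j ⌋

allB : {A : Set} → (A → Bool) → List A → Bool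
allB p []       = true
allB p (x ∷ xs) = p x ∧ allB p xs

-- f is an embedding of H into G: injective on vertices and maps edges to edges
-- (subgraph embedding, not necessarily induced).
isEmbedding : ∀ {k n} → Graph k → Graph n → Vec (Fin n) k → Bool
isEmbedding {k} H G f =
  allB (λ i → allB (λ j →
        (eqᶠ i j ∨ not (eqᶠ (lookup f i) (lookup f j)))
      ∧ (not (adj H i j) ∨ adj G (lookup f i) (lookup f j)))
      (allFin k)) (allFin k)

emb : ∀ {k n} → Graph k → Graph n → ℕ
emb {k} {n} H G = length (filter (λ f → isEmbedding H G f ≡? true) (allMaps k n))
  where
  open import Data.Bool.Properties using () renaming (_≟_ to _≡?_)

-- exact division (the divisor |Aut H| is always ≥ 1)
divℕ : ℕ → ℕ → ℕ
divℕ m zero    = zero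
divℕ m (suc d) = m / suc d

-- Number of copies of H in G (as subgraphs) = #embeddings / |Aut(H)|.
copies : ∀ {k n} → Graph k → Graph n → ℕ
copies H G = divℕ (emb H G) (emb H H)

isZero : ∀ {n} → Fin n → Bool
isZero zero    = true
isZero (suc _) = false

star : (t : ℕ) → Graph (suc t)
star t = record { adj = a ; sym = s ; irrefl = r }
  where
  a : Fin (suc t) → Fin (suc t) → Bool
  a i j = (isZero i ∧ not (isZero j)) ∨ (isZero j ∧ not (isZero i))
  s : ∀ i j → a i j ≡ a j i
  s zero zero = Relation.Binary.PropositionalEquality.refl
  s zero (suc j) = Relation.Binary.PropositionalEquality.refl
  s (suc i) zero = Relation.Binary.PropositionalEquality.refl
  s (suc i) (suc j) = Relation.Binary.PropositionalEquality.refl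
  r : ∀ i → a i i ≡ false
  r zero = Relation.Binary.PropositionalEquality.refl
  r (suc i) = Relation.Binary.PropositionalEquality.refl

Family : Set
Family = List (Σ ℕ Graph)

Free : ∀ {n} → Family → Graph n → Set
Free 𝓕 G = ∀ {F} → F ∈ 𝓕 → emb (proj₂ F) G ≡ 0

-- "ex(n,H,𝓕) ≤ b"  (ex is a maximum over the finite set of 𝓕-free graphs)
ExAtMost : ∀ {k} → Graph k → Family → ℕ → ℕ → Set
ExAtMost H 𝓕 n b = (G : Graph n) → Free 𝓕 G → copies H G ≤ b

-- "ex(n,H,𝓕) ≥ b",  scaled: b ≤ d · ex(n,H,𝓕)
ExAtLeastScaled : ∀ {k} → Graph k → Family → ℕ → ℕ → ℕ → Set
ExAtLeastScaled H 𝓕 n d b = Σ (Graph n) λ G → Free 𝓕 G × (b ≤ d * copies H G)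

ExBounded : ∀ {k} → Graph k → Family → Set
ExBounded H 𝓕 = ∃[ N ] ∃[ C ] (∀ n → N ≤ n → ExAtMost H 𝓕 n C)

-- ex(n,H,𝓕) = Θ(n):  n/d ≤ ex ≤ C n  for all large n
ExLinear : ∀ {k} → Graph k → Family → Set
ExLinear H 𝓕 = ∃[ N ] ∃[ C ] ∃[ d ]
  (∀ n → N ≤ n → ExAtLeastScaled H 𝓕 n d n × ExAtMost H 𝓕 n (C * n))

-- ex(n,H,𝓕) = Ω(n^t):  n^t/d ≤ ex  for all large n
ExOmegaPow : ∀ {k} → Graph k → Family → ℕ → Set
ExOmegaPow H 𝓕 t = ∃[ N ] ∃[ d ] (∀ n → N ≤ n → ExAtLeastScaled H 𝓕 n d (n ^ t))

-- Two host families decide the regime: the stars K₁,ₘ and the forests of disjoint copies of S_t.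
-- If no F ∈ 𝓕 embeds in a star, every star K₁,ₙ₋₁ is 𝓕-free and contains Ω(nᵗ) copies of S_t.
-- Otherwise some F₀ ∈ 𝓕 embeds in a star, so 𝓕-free graphs have maximum degree at most |F₀|, and
-- counting stars by their centre gives O(n) copies. Then either no F ∈ 𝓕 embeds in a star forest,
-- and star forests give Ω(n) copies; or some F₁ embeds in k₁ disjoint copies of S_t, so an 𝓕-free
-- graph has no k₁ disjoint copies of S_t. In that case a maximal greedy packing has fewer than k₁
-- stars, every copy of S_t has its centre in the closed neighbourhood of the packing, and bounded
-- degree makes the count O(1). Whether F embeds in some star (forest) is decided on the one with
-- |F| + 1 vertices (|F| stars), since any embedding can be relabelled into it.

module Submission where

open import Defs
open import Data.Nat using (ℕ; _≤_)
open import Data.Sum using (_⊎_)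

open import Data.Bool using (Bool; true; false; _∧_; _∨_; not)
open import Data.Bool.Properties using (∧-assoc; ∧-identityʳ; ∧-zeroʳ; ∨-zeroʳ; not-involutive)
  renaming (_≟_ to _≟ᵇ_)
open import Data.Empty using (⊥-elim)
open import Data.Fin using (Fin; zero; suc; toℕ; fromℕ<)
open import Data.Fin.Properties using (toℕ<n; toℕ-fromℕ<; toℕ-injective) renaming (_≟_ to _≟ᶠ_)
open import Data.List using (List; []; _∷_; _++_; map; concatMap; filter; length; tabulate)
open import Data.List.Membership.Propositional using (_∈_; find)
import Data.List.Relation.Unary.All as All
open import Data.List.Relation.Unary.All.Properties using (¬All⇒Any¬)
open import Data.Nat using (zero; suc; _+_; _*_; _^_; _∸_; _<_; z≤n; s≤s; NonZero; >-nonZero; _≟_; _≤?_)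
open import Data.Nat.Divisibility using (n∣m*n)
open import Data.Nat.DivMod
open import Data.Nat.Properties
open import Algebra.Properties.Semiring.Sum +-*-semiring
  using (sum; sum-cong-≗; sum-replicate-zero; ∑-distrib-+; *-distribʳ-sum)
open import Data.Nat.Tactic.RingSolver using (solve-∀)
open import Data.Product using (_×_; _,_; proj₁; proj₂; ∃)
open import Data.Sum using (inj₁; inj₂)
open import Data.Vec using (Vec; []; _∷_; lookup)
open import Data.Vec.Properties using (lookup-map; lookup∘tabulate)
open import Function using (_∘_; id)
open import Relation.Nullary using (Dec; yes; no; ¬_)
open import Relation.Nullary.Decidable using (⌊_⌋; dec-true; dec-false; isYes≗does)
open import Relation.Binary.PropositionalEquality as ≡
  using (_≡_; _≢_; refl; trans; cong; cong₂; subst; subst₂; module ≡-Reasoning)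

∧-true : ∀ {a b} → a ∧ b ≡ true → a ≡ true × b ≡ true
∧-true {true} {true} _ = refl , refl

∨-not-mp : ∀ {a b} → (a ∨ not b) ≡ true → b ≡ true → a ≡ true
∨-not-mp {true}          _  _  = refl
∨-not-mp {false} {true}  () _
∨-not-mp {false} {false} _  ()

not-∨-mp : ∀ {a b} → (not a ∨ b) ≡ true → a ≡ true → b ≡ true
not-∨-mp {true} h refl = h

⌊⌋⇒ : {A : Set} (a? : Dec A) → ⌊ a? ⌋ ≡ true → A
⌊⌋⇒ (yes a) _ = a

⇒⌊⌋ : {A : Set} (a? : Dec A) → A → ⌊ a? ⌋ ≡ true
⇒⌊⌋ a? a = trans (isYes≗does a?) (dec-true a? a)

⌊≟⌋-sym : ∀ a b → ⌊ a ≟ b ⌋ ≡ ⌊ b ≟ a ⌋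
⌊≟⌋-sym a b with a ≟ b | b ≟ a
... | yes _   | yes _   = refl
... | no  _   | no  _   = refl
... | yes a≡b | no  b≢a = ⊥-elim (b≢a (≡.sym a≡b))
... | no  a≢b | yes b≡a = ⊥-elim (a≢b (≡.sym b≡a))

eqᶠ⇒≡ : ∀ {n} {i j : Fin n} → eqᶠ i j ≡ true → i ≡ j
eqᶠ⇒≡ {i = i} {j} = ⌊⌋⇒ (i ≟ᶠ j)

eqᶠ-refl : ∀ {n} (i : Fin n) → eqᶠ i i ≡ true
eqᶠ-refl i = ⇒⌊⌋ (i ≟ᶠ i) refl

≢⇒eqᶠ-false : ∀ {n} {i j : Fin n} → i ≢ j → eqᶠ i j ≡ false
≢⇒eqᶠ-false {i = i} {j} i≢j = trans (isYes≗does (i ≟ᶠ j)) (dec-false (i ≟ᶠ j) i≢j)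

eqᶠ-suc : ∀ {n} (i j : Fin n) → eqᶠ {suc n} (suc i) (suc j) ≡ eqᶠ i j
eqᶠ-suc i j with i ≟ᶠ j
... | yes refl = refl
... | no _     = refl

χ : Bool → ℕ
χ true  = 1
χ false = 0

χ-mono : ∀ {a b} → (a ≡ true → b ≡ true) → χ a ≤ χ b
χ-mono {false} _ = z≤n
χ-mono {true}  h rewrite h refl = ≤-refl

χ-∨ : ∀ a b → χ (a ∨ b) ≤ χ a + χ b
χ-∨ true  _ = s≤s z≤n
χ-∨ false _ = ≤-refl

m≤2*[m/n]*n : ∀ m n .{{_ : NonZero n}} → n ≤ m → m ≤ 2 * (m / n * n)
m≤2*[m/n]*n m n n≤m = begin
    m                        ≡⟨ m≡m%n+[m/n]*n m n ⟩
    m % n + m / n * n        ≤⟨ +-monoˡ-≤ (m / n * n) (<⇒≤ (m%n<n m n)) ⟩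
    n + m / n * n            ≤⟨ +-monoˡ-≤ (m / n * n) (m≤n*m n (m / n) {{>-nonZero (m≥n⇒m/n>0 n≤m)}}) ⟩
    m / n * n + m / n * n    ≡⟨ cong (m / n * n +_) (+-identityʳ (m / n * n)) ⟨
    2 * (m / n * n)          ∎
  where open ≤-Reasoning

divℕ-≤ : ∀ m d → divℕ m d ≤ m
divℕ-≤ m zero    = z≤n
divℕ-≤ m (suc d) = m/n≤m m (suc d)

≤-2*-divℕ : ∀ {d} x m → 1 ≤ d → d ≤ x → x ≤ m → x ≤ 2 * d * divℕ m d
≤-2*-divℕ {suc d} x m _ d≤x x≤m = begin
    x                               ≤⟨ m≤2*[m/n]*n x (suc d) d≤x ⟩
    2 * (x / suc d * suc d)         ≤⟨ *-monoʳ-≤ 2 (*-monoˡ-≤ (suc d) (/-monoˡ-≤ (suc d) x≤m)) ⟩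
    2 * (m / suc d * suc d)         ≡⟨ cong (2 *_) (*-comm (m / suc d) (suc d)) ⟩
    2 * (suc d * (m / suc d))       ≡⟨ *-assoc 2 (suc d) (m / suc d) ⟨
    2 * suc d * (m / suc d)         ∎
  where open ≤-Reasoning

^-distribʳ-* : ∀ a b k → (a * b) ^ k ≡ a ^ k * b ^ k
^-distribʳ-* a b zero    = refl
^-distribʳ-* a b (suc k) = trans (cong (a * b *_) (^-distribʳ-* a b k)) (swap a b (a ^ k) (b ^ k))
  where
  swap : ∀ a b x y → a * b * (x * y) ≡ a * x * (b * y)
  swap = solve-∀

m≤m^n : ∀ m n → 1 ≤ m → 1 ≤ n → m ≤ m ^ n
m≤m^n m (suc n) 1≤m _ = subst (_≤ m * m ^ n) (*-identityʳ m) (*-monoʳ-≤ m (m^n>0 m {{>-nonZero 1≤m}} n))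

sum-mono-≤ : ∀ {m} {f g : Fin m → ℕ} → (∀ i → f i ≤ g i) → sum f ≤ sum g
sum-mono-≤ {zero}  _ = z≤n
sum-mono-≤ {suc m} h = +-mono-≤ (h zero) (sum-mono-≤ (h ∘ suc))

sum-≤-* : ∀ {m} {f : Fin m → ℕ} b → (∀ i → f i ≤ b) → sum f ≤ m * b
sum-≤-* {zero}  _ _ = z≤n
sum-≤-* {suc m} b h = +-mono-≤ (h zero) (sum-≤-* b (h ∘ suc))

≤-sum : ∀ {m} (f : Fin m → ℕ) i → f i ≤ sum f
≤-sum f zero    = m≤m+n (f zero) _
≤-sum f (suc i) = ≤-trans (≤-sum (f ∘ suc) i) (m≤n+m _ (f zero))

sum-positive : ∀ {m} (f : Fin m → ℕ) → 1 ≤ sum f → ∃ λ i → 1 ≤ f i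
sum-positive {suc m} f h with f zero in eq
... | suc _ = zero , subst (1 ≤_) (≡.sym eq) (s≤s z≤n)
... | zero  = let i , p = sum-positive (f ∘ suc) h in suc i , p

count : ∀ {k n} → (Vec (Fin n) k → Bool) → ℕ
count {zero}  P = χ (P [])
count {suc k} P = sum λ i → count λ w → P (i ∷ w)

count-cong : ∀ {k n} {P Q : Vec (Fin n) k → Bool} → (∀ v → P v ≡ Q v) → count P ≡ count Q
count-cong {zero}  e = cong χ (e [])
count-cong {suc k} e = sum-cong-≗ λ i → count-cong λ w → e (i ∷ w)

count-mono : ∀ {k n} {P Q : Vec (Fin n) k → Bool} →
  (∀ v → P v ≡ true → Q v ≡ true) → count P ≤ count Q
count-mono {zero}  h = χ-mono (h [])
count-mono {suc k} h = sum-mono-≤ λ i → count-mono λ w → h (i ∷ w)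

count-∨ : ∀ {k n} (P Q : Vec (Fin n) k → Bool) → count (λ v → P v ∨ Q v) ≤ count P + count Q
count-∨ {zero}  P Q = χ-∨ (P []) (Q [])
count-∨ {suc k} P Q = ≤-trans (sum-mono-≤ λ i → count-∨ (P ∘ (i ∷_)) (Q ∘ (i ∷_)))
  (≤-reflexive (∑-distrib-+ (λ i → count (P ∘ (i ∷_))) (λ i → count (Q ∘ (i ∷_)))))

count-false : ∀ {k n} → count {k} {n} (λ _ → false) ≡ 0
count-false {zero}      = refl
count-false {suc k} {n} = trans (sum-cong-≗ {n} λ _ → count-false {k} {n}) (sum-replicate-zero n)

count-const-∧ : ∀ {k n} b (Q : Vec (Fin n) k → Bool) → count (λ w → b ∧ Q w) ≡ χ b * count Q
count-const-∧ true  Q = ≡.sym (+-identityʳ (count Q))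
count-const-∧ {k} false Q = count-false {k}

count-positive : ∀ {k n} (P : Vec (Fin n) k → Bool) v → P v ≡ true → 1 ≤ count P
count-positive P []      h rewrite h = ≤-refl
count-positive P (x ∷ v) h = ≤-trans (count-positive (P ∘ (x ∷_)) v h) (≤-sum _ x)

count-witness : ∀ {k n} (P : Vec (Fin n) k → Bool) → 1 ≤ count P → ∃ λ v → P v ≡ true
count-witness {zero}  P h with P [] in eq
... | true = [] , eq
count-witness {suc k} P h =
  let i , p = sum-positive _ h
      w , q = count-witness (P ∘ (i ∷_)) p
  in i ∷ w , q

countᴸ : {A : Set} → (A → Bool) → List A → ℕ
countᴸ p []       = 0
countᴸ p (x ∷ xs) = χ (p x) + countᴸ p xs

length-filter≡countᴸ : {A : Set} (p : A → Bool) (xs : List A) →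
  length (filter (λ x → p x ≟ᵇ true) xs) ≡ countᴸ p xs
length-filter≡countᴸ p []       = refl
length-filter≡countᴸ p (x ∷ xs) with p x
... | true  = cong suc (length-filter≡countᴸ p xs)
... | false = length-filter≡countᴸ p xs

countᴸ-++ : {A : Set} (p : A → Bool) (xs ys : List A) → countᴸ p (xs ++ ys) ≡ countᴸ p xs + countᴸ p ys
countᴸ-++ p []       ys = refl
countᴸ-++ p (x ∷ xs) ys = trans (cong (χ (p x) +_) (countᴸ-++ p xs ys)) (≡.sym (+-assoc (χ (p x)) _ _))

countᴸ-map : {A B : Set} (p : B → Bool) (h : A → B) (xs : List A) → countᴸ p (map h xs) ≡ countᴸ (p ∘ h) xs
countᴸ-map p h []       = refl
countᴸ-map p h (x ∷ xs) = cong (χ (p (h x)) +_) (countᴸ-map p h xs)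

countᴸ-concatMap-tabulate : {A B : Set} (p : B → Bool) (g : A → List B) {n : ℕ} (h : Fin n → A) →
  countᴸ p (concatMap g (tabulate h)) ≡ sum (λ i → countᴸ p (g (h i)))
countᴸ-concatMap-tabulate p g {zero}  h = refl
countᴸ-concatMap-tabulate p g {suc n} h =
  trans (countᴸ-++ p (g (h zero)) _) (cong (_ +_) (countᴸ-concatMap-tabulate p g (h ∘ suc)))

countᴸ-allMaps : ∀ {k n} (P : Vec (Fin n) k → Bool) → countᴸ P (allMaps k n) ≡ count P
countᴸ-allMaps {zero}      P = +-identityʳ (χ (P []))
countᴸ-allMaps {suc k} {n} P = trans (countᴸ-concatMap-tabulate P (λ i → map (i ∷_) (allMaps k n)) id)
  (sum-cong-≗ {n} λ i → trans (countᴸ-map P (i ∷_) (allMaps k n)) (countᴸ-allMaps (P ∘ (i ∷_))))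

card : ∀ {n} → (Fin n → Bool) → ℕ
card p = sum (χ ∘ p)

card-cong : ∀ {n} {p q : Fin n → Bool} → (∀ x → p x ≡ q x) → card p ≡ card q
card-cong e = sum-cong-≗ (cong χ ∘ e)

card-true : ∀ n → card {n} (λ _ → true) ≡ n
card-true zero    = refl
card-true (suc n) = cong suc (card-true n)

card-single : ∀ {n} (y : Fin n) → card (λ x → eqᶠ x y) ≡ 1
card-single {suc n} zero    = cong suc (trans
  (card-cong {n} {q = λ _ → false} λ x → ≢⇒eqᶠ-false {i = suc x} {zero} λ ()) (sum-replicate-zero n))
card-single {suc n} (suc y) = trans (card-cong {n} λ x → eqᶠ-suc x y) (card-single y)

card-∨ : ∀ {n} (p q : Fin n → Bool) → card (λ x → p x ∨ q x) ≤ card p + card q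
card-∨ p q = ≤-trans (sum-mono-≤ λ x → χ-∨ (p x) (q x)) (≤-reflexive (∑-distrib-+ (χ ∘ p) (χ ∘ q)))

notIn : ∀ {n} → Fin n → List (Fin n) → Bool
notIn x = allB λ y → not (eqᶠ x y)

card-remove : ∀ {n} (p : Fin n → Bool) y → card p ∸ 1 ≤ card (λ x → p x ∧ not (eqᶠ x y))
card-remove p y = m≤n+o⇒m∸n≤o (card p) 1 (begin
    card p                                                ≤⟨ sum-mono-≤ (λ x → split (p x) (eqᶠ x y)) ⟩
    sum (λ x → χ (eqᶠ x y) + χ (p x ∧ not (eqᶠ x y)))     ≡⟨ ∑-distrib-+ (χ ∘ λ x → eqᶠ x y) (χ ∘ p∖y) ⟩
    card (λ x → eqᶠ x y) + card p∖y                       ≡⟨ cong (_+ card p∖y) (card-single y) ⟩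
    1 + card p∖y                                          ∎)
  where
  open ≤-Reasoning
  p∖y = λ x → p x ∧ not (eqᶠ x y)
  split : ∀ a b → χ a ≤ χ b + χ (a ∧ not b)
  split false _     = z≤n
  split true  false = ≤-refl
  split true  true  = s≤s z≤n

card-notIn : ∀ {n} (p : Fin n → Bool) L → card p ∸ length L ≤ card (λ x → p x ∧ notIn x L)
card-notIn p []      = ≤-reflexive (card-cong λ x → ≡.sym (∧-identityʳ (p x)))
card-notIn p (y ∷ L) = begin
    card p ∸ suc (length L)             ≡⟨ ≡.sym (∸-+-assoc (card p) 1 (length L)) ⟩
    card p ∸ 1 ∸ length L               ≤⟨ ∸-monoˡ-≤ (length L) (card-remove p y) ⟩
    card p∖y ∸ length L                 ≤⟨ card-notIn p∖y L ⟩
    card (λ x → p∖y x ∧ notIn x L)      ≡⟨ card-cong (λ x → ∧-assoc (p x) _ _) ⟩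
    card (λ x → p x ∧ notIn x (y ∷ L))  ∎
  where
  open ≤-Reasoning
  p∖y = λ x → p x ∧ not (eqᶠ x y)

allᵥ : ∀ {k n} → (Fin n → Bool) → Vec (Fin n) k → Bool
allᵥ p []      = true
allᵥ p (x ∷ w) = p x ∧ allᵥ p w

allᵥ⁺ : ∀ {k n} (p : Fin n → Bool) (w : Vec (Fin n) k) → (∀ j → p (lookup w j) ≡ true) → allᵥ p w ≡ true
allᵥ⁺ p []      h = refl
allᵥ⁺ p (x ∷ w) h rewrite h zero = allᵥ⁺ p w (h ∘ suc)

count-allᵥ : ∀ {k n} (p : Fin n → Bool) → count {k} (allᵥ p) ≡ card p ^ k
count-allᵥ {zero}      p = refl
count-allᵥ {suc k} {n} p = begin
    sum (λ i → count (λ w → p i ∧ allᵥ {k} p w))  ≡⟨ sum-cong-≗ {n} (λ i → count-const-∧ (p i) (allᵥ {k} p)) ⟩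
    sum (λ i → χ (p i) * count (allᵥ {k} p))      ≡⟨ *-distribʳ-sum (count (allᵥ {k} p)) (χ ∘ p) ⟨
    card p * count (allᵥ {k} p)                   ≡⟨ cong (card p *_) (count-allᵥ {k} p) ⟩
    card p * card p ^ k                           ∎
  where open ≡-Reasoning

fresh : ∀ {k n} → (Fin n → Bool) → List (Fin n) → Vec (Fin n) k → Bool
fresh p L []      = true
fresh p L (x ∷ w) = (p x ∧ notIn x L) ∧ fresh p (x ∷ L) w

count-fresh : ∀ {n} k (p : Fin n → Bool) L → (card p ∸ (length L + k)) ^ k ≤ count (fresh {k} p L)
count-fresh zero        p L = ≤-refl
count-fresh {n} (suc k) p L = begin
    X * X ^ k                                          ≡⟨ cong (λ m → X * (card p ∸ m) ^ k) (+-suc (length L) k) ⟩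
    X * B                                              ≤⟨ *-monoˡ-≤ B X≤card-q ⟩
    card q * B                                         ≡⟨ *-distribʳ-sum B (χ ∘ q) ⟩
    sum (λ x → χ (q x) * B)                            ≤⟨ sum-mono-≤ (λ x → *-monoʳ-≤ (χ (q x))
                                                            (count-fresh k p (x ∷ L))) ⟩
    sum (λ x → χ (q x) * count (fresh {k} p (x ∷ L)))  ≡⟨ sum-cong-≗ {n} (λ x → count-const-∧ (q x)
                                                            (fresh {k} p (x ∷ L))) ⟨
    count (fresh {suc k} p L)                          ∎
  where
  open ≤-Reasoning
  q = λ x → p x ∧ notIn x L
  X = card p ∸ (length L + suc k)
  B = (card p ∸ (suc (length L) + k)) ^ k
  X≤card-q : X ≤ card q
  X≤card-q = ≤-trans (∸-monoʳ-≤ (card p) (m≤m+n (length L) (suc k))) (card-notIn p L)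

notIn-head : ∀ {n} {x y : Fin n} {L} → notIn x (y ∷ L) ≡ true → x ≢ y
notIn-head {x = x} {L = L} h refl with trans (cong (λ b → not b ∧ notIn x L) (≡.sym (eqᶠ-refl x))) h
... | ()

fresh-sound : ∀ {k n} (p : Fin n → Bool) L (w : Vec (Fin n) k) → fresh p L w ≡ true →
  (∀ j → p (lookup w j) ≡ true) × (∀ j → notIn (lookup w j) L ≡ true) ×
  (∀ i j → lookup w i ≡ lookup w j → i ≡ j)
fresh-sound p L []      _ = (λ ()) , (λ ()) , (λ ())
fresh-sound p L (x ∷ w) h = satisfies , avoids , injective
  where
  head-ok = proj₁ (∧-true h)
  ih = fresh-sound p (x ∷ L) w (proj₂ (∧-true h))
  satisfies : ∀ j → p (lookup (x ∷ w) j) ≡ true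
  satisfies zero    = proj₁ (∧-true head-ok)
  satisfies (suc j) = proj₁ ih j
  avoids : ∀ j → notIn (lookup (x ∷ w) j) L ≡ true
  avoids zero    = proj₂ (∧-true head-ok)
  avoids (suc j) = proj₂ (∧-true (proj₁ (proj₂ ih) j))
  injective : ∀ i j → lookup (x ∷ w) i ≡ lookup (x ∷ w) j → i ≡ j
  injective zero    zero    _ = refl
  injective zero    (suc j) e = ⊥-elim (notIn-head {L = L} (proj₁ (proj₂ ih) j) (≡.sym e))
  injective (suc i) zero    e = ⊥-elim (notIn-head {L = L} (proj₁ (proj₂ ih) i) e)
  injective (suc i) (suc j) e = cong suc (proj₂ (proj₂ ih) i j e)

record Embedding {k n} (H : Graph k) (G : Graph n) (f : Vec (Fin n) k) : Set where
  field
    injective : ∀ i j → lookup f i ≡ lookup f j → i ≡ j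
    adjacent  : ∀ i j → adj H i j ≡ true → adj G (lookup f i) (lookup f j) ≡ true
open Embedding

allB-tabulate⁻ : ∀ {A : Set} {n} (p : A → Bool) (f : Fin n → A) →
  allB p (tabulate f) ≡ true → ∀ i → p (f i) ≡ true
allB-tabulate⁻ p f h zero    = proj₁ (∧-true h)
allB-tabulate⁻ p f h (suc i) = allB-tabulate⁻ p (f ∘ suc) (proj₂ (∧-true h)) i

allB-tabulate⁺ : ∀ {A : Set} {n} (p : A → Bool) (f : Fin n → A) →
  (∀ i → p (f i) ≡ true) → allB p (tabulate f) ≡ true
allB-tabulate⁺ {n = zero}  p f h = refl
allB-tabulate⁺ {n = suc n} p f h rewrite h zero = allB-tabulate⁺ p (f ∘ suc) (h ∘ suc)

module _ {k n} (H : Graph k) (G : Graph n) (f : Vec (Fin n) k) where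

  distinctOk edgeOk : Fin k → Fin k → Bool
  distinctOk i j = eqᶠ i j ∨ not (eqᶠ (lookup f i) (lookup f j))
  edgeOk     i j = not (adj H i j) ∨ adj G (lookup f i) (lookup f j)

  isEmbedding⇒Embedding : isEmbedding H G f ≡ true → Embedding H G f
  isEmbedding⇒Embedding h = record
    { injective = λ i j e → eqᶠ⇒≡ (∨-not-mp (distinct i j)
                                (subst (λ y → eqᶠ (lookup f i) y ≡ true) e (eqᶠ-refl _)))
    ; adjacent  = λ i j → not-∨-mp (edge i j)
    }
    where
    pairOk : ∀ i j → (distinctOk i j ∧ edgeOk i j) ≡ true
    pairOk i j = allB-tabulate⁻ _ id (allB-tabulate⁻ _ id h i) j
    distinct = λ i j → proj₁ (∧-true (pairOk i j))
    edge     = λ i j → proj₂ (∧-true (pairOk i j))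

  Embedding⇒isEmbedding : Embedding H G f → isEmbedding H G f ≡ true
  Embedding⇒isEmbedding e = allB-tabulate⁺ _ id λ i → allB-tabulate⁺ _ id λ j →
    cong₂ _∧_ (distinct i j) (edge i j)
    where
    distinct : ∀ i j → distinctOk i j ≡ true
    distinct i j with i ≟ᶠ j
    ... | yes refl = refl
    ... | no i≢j   = cong not (≢⇒eqᶠ-false (i≢j ∘ injective e i j))
    edge : ∀ i j → edgeOk i j ≡ true
    edge i j with adj H i j in aij
    ... | true  = adjacent e i j aij
    ... | false = refl

emb≡count : ∀ {k n} (H : Graph k) (G : Graph n) → emb H G ≡ count (isEmbedding H G)
emb≡count {k} {n} H G =
  trans (length-filter≡countᴸ (isEmbedding H G) (allMaps k n)) (countᴸ-allMaps (isEmbedding H G))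

Embedding⇒emb-positive : ∀ {k n} {H : Graph k} {G : Graph n} f → Embedding H G f → 1 ≤ emb H G
Embedding⇒emb-positive {H = H} {G} f e =
  subst (1 ≤_) (≡.sym (emb≡count H G)) (count-positive _ f (Embedding⇒isEmbedding H G f e))

emb-positive⇒Embedding : ∀ {k n} (H : Graph k) (G : Graph n) → 1 ≤ emb H G → ∃ (Embedding H G)
emb-positive⇒Embedding H G h =
  let f , p = count-witness _ (subst (1 ≤_) (emb≡count H G) h) in f , isEmbedding⇒Embedding H G f p

∘-Embedding : ∀ {k m n} {F : Graph k} {H : Graph m} {G : Graph n} {e s} →
  Embedding F H e → Embedding H G s → Embedding F G (Data.Vec.map (lookup s) e)
∘-Embedding {G = G} {e} {s} E S = record
  { injective = λ i j p → injective E i j (injective S _ _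
                  (trans (≡.sym (lookup-map i (lookup s) e)) (trans p (lookup-map j (lookup s) e))))
  ; adjacent  = λ i j a → subst₂ (λ x y → adj G x y ≡ true)
                  (≡.sym (lookup-map i (lookup s) e)) (≡.sym (lookup-map j (lookup s) e))
                  (adjacent S _ _ (adjacent E i j a))
  }

emb≡0⇒¬Embedding : ∀ {k n} {H : Graph k} {G : Graph n} → emb H G ≡ 0 → ∀ f → ¬ Embedding H G f
emb≡0⇒¬Embedding H↛G f E with () ← subst (1 ≤_) H↛G (Embedding⇒emb-positive f E)

Embedding-transfers-emb≡0 : ∀ {k n m} (F : Graph k) (G : Graph n) (G′ : Graph m) →
  (∀ f → Embedding F G f → ∃ (Embedding F G′)) → emb F G′ ≡ 0 → emb F G ≡ 0
Embedding-transfers-emb≡0 F G G′ transfer F↛G′ with emb F G in eq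
... | zero  = refl
... | suc _ with f , E ← emb-positive⇒Embedding F G (subst (1 ≤_) (≡.sym eq) (s≤s z≤n))
            with g , E′ ← transfer f E = ⊥-elim (emb≡0⇒¬Embedding F↛G′ g E′)

copies-≤-emb : ∀ {k n} (H : Graph k) (G : Graph n) → copies H G ≤ emb H G
copies-≤-emb H G = divℕ-≤ (emb H G) (emb H H)

emb-self-positive : ∀ {k} (H : Graph k) → 1 ≤ emb H H
emb-self-positive H = Embedding⇒emb-positive {H = H} {H} (Data.Vec.tabulate id) (record
  { injective = λ i j e → trans (≡.sym (lookup∘tabulate id i)) (trans e (lookup∘tabulate id j))
  ; adjacent  = λ i j a → subst₂ (λ x y → adj H x y ≡ true)
                  (≡.sym (lookup∘tabulate id i)) (≡.sym (lookup∘tabulate id j)) a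
  })

-- emb H H = |Aut H|; the factor 2 pays for rounding down in copies H G = ⌊emb H G / |Aut H|⌋
≤-2*|Aut|*copies : ∀ {k n} (H : Graph k) (G : Graph n) x → emb H H ≤ x → x ≤ emb H G →
  x ≤ 2 * emb H H * copies H G
≤-2*|Aut|*copies H G x = ≤-2*-divℕ x (emb H G) (emb-self-positive H)

-- Stars and star forests as host graphs

Realises : ∀ {n} → (ℕ → ℕ → Bool) → Graph n → Set
Realises R G = ∀ x y → adj G x y ≡ R (toℕ x) (toℕ y)

relabel : ∀ {k n m} (R : ℕ → ℕ → Bool) {F : Graph k} {G : Graph n} {G′ : Graph m} →
  Realises R G → Realises R G′ → (f : Vec (Fin n) k) → Embedding F G f → (φ : ℕ → ℕ) →
  let label = λ i → toℕ (lookup f i) in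
  (∀ i j → R (label i) (label j) ≡ true → R (φ (label i)) (φ (label j)) ≡ true) →
  (∀ i j → φ (label i) ≡ φ (label j) → label i ≡ label j) →
  (∀ i → φ (label i) < m) →
  ∃ (Embedding F G′)
relabel R {F} {G} {G′} realG realG′ f E φ φ-pres φ-inj φ-< = g , record
  { injective = λ i j p → injective E i j (toℕ-injective (φ-inj i j
                  (trans (≡.sym (toℕ-g i)) (trans (cong toℕ p) (toℕ-g j)))))
  ; adjacent  = λ i j a → trans (realG′ _ _) (subst₂ (λ x y → R x y ≡ true) (≡.sym (toℕ-g i)) (≡.sym (toℕ-g j))
                  (φ-pres i j (trans (≡.sym (realG _ _)) (adjacent E i j a))))
  }
  where
  g = Data.Vec.tabulate λ i → fromℕ< (φ-< i)
  toℕ-g : ∀ i → toℕ (lookup g i) ≡ φ (toℕ (lookup f i))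
  toℕ-g i = trans (cong toℕ (lookup∘tabulate _ i)) (toℕ-fromℕ< (φ-< i))

firstIndex : ∀ {k} → ℕ → (Fin k → ℕ) → ℕ
firstIndex {zero}  a ℓ = 0
firstIndex {suc k} a ℓ with a ≟ ℓ zero
... | yes _ = 0
... | no  _ = suc (firstIndex a (ℓ ∘ suc))

at : ∀ {k} → (Fin k → ℕ) → ℕ → ℕ
at {zero}  ℓ _       = 0
at {suc k} ℓ zero    = ℓ zero
at {suc k} ℓ (suc m) = at (ℓ ∘ suc) m

firstIndex-< : ∀ {k} (ℓ : Fin k → ℕ) i → firstIndex (ℓ i) ℓ < k
firstIndex-< ℓ zero with ℓ zero ≟ ℓ zero
... | yes _ = s≤s z≤n
... | no  ≢ = ⊥-elim (≢ refl)
firstIndex-< ℓ (suc i) with ℓ (suc i) ≟ ℓ zero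
... | yes _ = s≤s z≤n
... | no  _ = s≤s (firstIndex-< (ℓ ∘ suc) i)

at-firstIndex : ∀ {k} (ℓ : Fin k → ℕ) i → at ℓ (firstIndex (ℓ i) ℓ) ≡ ℓ i
at-firstIndex ℓ zero with ℓ zero ≟ ℓ zero
... | yes _ = refl
... | no  ≢ = ⊥-elim (≢ refl)
at-firstIndex ℓ (suc i) with ℓ (suc i) ≟ ℓ zero
... | yes ℓᵢ≡ℓ₀ = ≡.sym ℓᵢ≡ℓ₀
... | no  _     = at-firstIndex (ℓ ∘ suc) i

firstIndex-injective : ∀ {k} (ℓ : Fin k → ℕ) i j →
  firstIndex (ℓ i) ℓ ≡ firstIndex (ℓ j) ℓ → ℓ i ≡ ℓ j
firstIndex-injective ℓ i j e =
  trans (≡.sym (at-firstIndex ℓ i)) (trans (cong (at ℓ) e) (at-firstIndex ℓ j))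

starRel : ℕ → ℕ → Bool
starRel zero    zero    = false
starRel zero    (suc _) = true
starRel (suc _) zero    = true
starRel (suc _) (suc _) = false

starRel-sym : ∀ a b → starRel a b ≡ starRel b a
starRel-sym zero    zero    = refl
starRel-sym zero    (suc _) = refl
starRel-sym (suc _) zero    = refl
starRel-sym (suc _) (suc _) = refl

starRel-irrefl : ∀ a → starRel a a ≡ false
starRel-irrefl zero    = refl
starRel-irrefl (suc _) = refl

star-realises : ∀ m → Realises starRel (star m)
star-realises m zero    zero    = refl
star-realises m zero    (suc _) = refl
star-realises m (suc _) zero    = refl
star-realises m (suc _) (suc _) = refl

relabel-star : ∀ {k m} (F : Graph k) f → Embedding F (star m) f → ∃ (Embedding F (star k))
relabel-star {k} F f E = relabel starRel (star-realises _) (star-realises k) f E φ φ-pres φ-inj φ-<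
  where
  ℓ = λ i → toℕ (lookup f i)
  -- the centre keeps label 0; a leaf is renamed after its first position in f
  φ : ℕ → ℕ
  φ zero    = zero
  φ (suc a) = suc (firstIndex (suc a) ℓ)
  φ-starRel : ∀ a b → starRel (φ a) (φ b) ≡ starRel a b
  φ-starRel zero    zero    = refl
  φ-starRel zero    (suc _) = refl
  φ-starRel (suc _) zero    = refl
  φ-starRel (suc _) (suc _) = refl
  φ-pres : ∀ i j → starRel (ℓ i) (ℓ j) ≡ true → starRel (φ (ℓ i)) (φ (ℓ j)) ≡ true
  φ-pres i j = trans (φ-starRel (ℓ i) (ℓ j))
  φ-inj : ∀ i j → φ (ℓ i) ≡ φ (ℓ j) → ℓ i ≡ ℓ j
  φ-inj i j e with ℓ i in ℓi | ℓ j in ℓj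
  ... | zero  | zero  = refl
  ... | suc _ | suc _ = trans (≡.sym ℓi) (trans (firstIndex-injective ℓ i j
                          (subst₂ (λ a b → firstIndex a ℓ ≡ firstIndex b ℓ) (≡.sym ℓi) (≡.sym ℓj)
                                  (suc-injective e))) ℓj)
  φ-< : ∀ i → φ (ℓ i) < suc k
  φ-< i with ℓ i in ℓi
  ... | zero  = s≤s z≤n
  ... | suc _ = s≤s (subst (λ a → firstIndex a ℓ < k) ℓi (firstIndex-< ℓ i))

module _ (t : ℕ) where

  -- vertex a lies in block a / (t+1) at position a % (t+1); position 0 is the block's centre
  forestRel : ℕ → ℕ → Bool
  forestRel a b = ⌊ a / suc t ≟ b / suc t ⌋ ∧ starRel (a % suc t) (b % suc t)

  starForest : (n : ℕ) → Graph n
  starForest n = record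
    { adj    = λ x y → forestRel (toℕ x) (toℕ y)
    ; sym    = λ x y → cong₂ _∧_ (⌊≟⌋-sym (toℕ x / suc t) _) (starRel-sym (toℕ x % suc t) _)
    ; irrefl = λ x → let a = toℕ x in
                 trans (cong (_∧ starRel (a % suc t) (a % suc t)) (⇒⌊⌋ (a / suc t ≟ _) refl))
                       (starRel-irrefl (a % suc t))
    }

  [r+q*T]/T≡q : ∀ q r → r < suc t → (r + q * suc t) / suc t ≡ q
  [r+q*T]/T≡q q r r<T =
    trans (+-distrib-/-∣ʳ r (n∣m*n q)) (cong₂ _+_ (m<n⇒m/n≡0 r<T) (m*n/n≡m q (suc t)))

  [r+q*T]%T≡r : ∀ q r → r < suc t → (r + q * suc t) % suc t ≡ r
  [r+q*T]%T≡r q r r<T = trans ([m+kn]%n≡m%n r q (suc t)) (m<n⇒m%n≡m r<T)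

  forestRel-block : ∀ b {r r′} → r < suc t → r′ < suc t →
    forestRel (r + b * suc t) (r′ + b * suc t) ≡ starRel r r′
  forestRel-block b {r} {r′} r<T r′<T =
    cong₂ _∧_ (⇒⌊⌋ (_ ≟ _) (trans ([r+q*T]/T≡q b r r<T) (≡.sym ([r+q*T]/T≡q b r′ r′<T))))
              (cong₂ starRel ([r+q*T]%T≡r b r r<T) ([r+q*T]%T≡r b r′ r′<T))

  relabel-forest : ∀ {k n} (F : Graph k) f → Embedding F (starForest n) f → ∃ (Embedding F (starForest (k * suc t)))
  relabel-forest {k} F f E = relabel forestRel (λ _ _ → refl) (λ _ _ → refl) f E φ φ-pres φ-inj φ-<
    where
    T = suc t
    ℓ = λ i → toℕ (lookup f i)
    block = λ i → ℓ i / T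
    -- blocks are renumbered after their first occurrence in f, positions are kept
    φ : ℕ → ℕ
    φ a = a % T + firstIndex (a / T) block * T
    φ/T : ∀ a → φ a / T ≡ firstIndex (a / T) block
    φ/T a = [r+q*T]/T≡q (firstIndex (a / T) block) (a % T) (m%n<n a T)
    φ%T : ∀ a → φ a % T ≡ a % T
    φ%T a = [r+q*T]%T≡r (firstIndex (a / T) block) (a % T) (m%n<n a T)
    φ-pres : ∀ i j → forestRel (ℓ i) (ℓ j) ≡ true → forestRel (φ (ℓ i)) (φ (ℓ j)) ≡ true
    φ-pres i j h = cong₂ _∧_ (⇒⌊⌋ (_ ≟ _) sameBlock)
                             (trans (cong₂ starRel (φ%T (ℓ i)) (φ%T (ℓ j))) adjacentPositions)
      where
      adjacentPositions = proj₂ (∧-true h)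
      sameBlock : φ (ℓ i) / T ≡ φ (ℓ j) / T
      sameBlock = trans (φ/T (ℓ i)) (trans (cong (λ b → firstIndex b block) (⌊⌋⇒ (_ ≟ _) (proj₁ (∧-true h))))
                                           (≡.sym (φ/T (ℓ j))))
    φ-inj : ∀ i j → φ (ℓ i) ≡ φ (ℓ j) → ℓ i ≡ ℓ j
    φ-inj i j e = begin
        ℓ i                  ≡⟨ m≡m%n+[m/n]*n (ℓ i) T ⟩
        ℓ i % T + block i * T  ≡⟨ cong₂ (λ r q → r + q * T) same% same/ ⟩
        ℓ j % T + block j * T  ≡⟨ m≡m%n+[m/n]*n (ℓ j) T ⟨
        ℓ j                  ∎
      where
      open ≡-Reasoning
      same% : ℓ i % T ≡ ℓ j % T
      same% = trans (≡.sym (φ%T (ℓ i))) (trans (cong (_% T) e) (φ%T (ℓ j)))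
      same/ : block i ≡ block j
      same/ = firstIndex-injective block i j (trans (≡.sym (φ/T (ℓ i))) (trans (cong (_/ T) e) (φ/T (ℓ j))))
    φ-< : ∀ i → φ (ℓ i) < k * T
    φ-< i = begin-strict
        ℓ i % T + firstIndex (block i) block * T  <⟨ +-monoˡ-< _ (m%n<n (ℓ i) T) ⟩
        suc (firstIndex (block i) block) * T      ≤⟨ *-monoˡ-≤ T (firstIndex-< block i) ⟩
        k * T                                     ∎
      where open ≤-Reasoning

-- Counting stars by their centres

module _ (t : ℕ) {n} (G : Graph n) where

  star-Embedding⁺ : ∀ c (w : Vec (Fin n) t) → (∀ j → adj G c (lookup w j) ≡ true) →
    (∀ i j → lookup w i ≡ lookup w j → i ≡ j) → Embedding (star t) G (c ∷ w)
  star-Embedding⁺ c w c~w w-inj = record { injective = inj ; adjacent = adjc }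
    where
    c≢w : ∀ j → c ≢ lookup w j
    c≢w j c≡wⱼ with () ← trans (≡.sym (irrefl G c)) (trans (cong (adj G c) c≡wⱼ) (c~w j))
    inj : ∀ i j → lookup (c ∷ w) i ≡ lookup (c ∷ w) j → i ≡ j
    inj zero    zero    _ = refl
    inj zero    (suc j) e = ⊥-elim (c≢w j e)
    inj (suc i) zero    e = ⊥-elim (c≢w i (≡.sym e))
    inj (suc i) (suc j) e = cong suc (w-inj i j e)
    adjc : ∀ i j → adj (star t) i j ≡ true → adj G (lookup (c ∷ w) i) (lookup (c ∷ w) j) ≡ true
    adjc zero    (suc j) _ = c~w j
    adjc (suc i) zero    _ = trans (sym G _ c) (c~w i)

  star-Embedding⁻ : ∀ c (w : Vec (Fin n) t) → Embedding (star t) G (c ∷ w) →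
    ∀ j → adj G c (lookup w j) ≡ true
  star-Embedding⁻ c w E j = adjacent E zero (suc j) refl

  starsAt : Fin n → ℕ
  starsAt c = count λ w → isEmbedding (star t) G (c ∷ w)

  emb-star≡sum-starsAt : emb (star t) G ≡ sum starsAt
  emb-star≡sum-starsAt = emb≡count (star t) G

  starsAt-≥ : ∀ c → (card (adj G c) ∸ t) ^ t ≤ starsAt c
  starsAt-≥ c = ≤-trans (count-fresh t (adj G c) []) (count-mono λ w h →
    let c~w , _ , w-inj = fresh-sound (adj G c) [] w h
    in  Embedding⇒isEmbedding (star t) G (c ∷ w) (star-Embedding⁺ c w c~w w-inj))

  starsAt-≤ : ∀ c → starsAt c ≤ card (adj G c) ^ t
  starsAt-≤ c = ≤-trans (count-mono λ w h →
      allᵥ⁺ (adj G c) w (star-Embedding⁻ c w (isEmbedding⇒Embedding (star t) G (c ∷ w) h)))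
    (≤-reflexive (count-allᵥ {t} (adj G c)))

  high-degree⇒star : ∀ c → t < card (adj G c) → ∃ λ w → Embedding (star t) G (c ∷ w)
  high-degree⇒star c t<deg =
    let w , h = count-witness (λ w → isEmbedding (star t) G (c ∷ w)) (≤-trans excess>0 (starsAt-≥ c))
    in  w , isEmbedding⇒Embedding (star t) G (c ∷ w) h
    where
    excess>0 : 1 ≤ (card (adj G c) ∸ t) ^ t
    excess>0 = m^n>0 (card (adj G c) ∸ t) ⦃ >-nonZero (m<n⇒0<n∸m t<deg) ⦄ t

emb-star-star-≥ : ∀ t m → (m ∸ t) ^ t ≤ emb (star t) (star m)
emb-star-star-≥ t m = begin
    (m ∸ t) ^ t                                ≡⟨ cong (λ d → (d ∸ t) ^ t) (card-true m) ⟨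
    (card (adj (star m) zero) ∸ t) ^ t         ≤⟨ starsAt-≥ t (star m) zero ⟩
    starsAt t (star m) zero                    ≤⟨ ≤-sum (starsAt t (star m)) zero ⟩
    sum (starsAt t (star m))                   ≡⟨ emb-star≡sum-starsAt t (star m) ⟨
    emb (star t) (star m)                      ∎
  where open ≤-Reasoning

emb-star-≤ : ∀ t {n} (G : Graph n) D → (∀ v → card (adj G v) ≤ D) → emb (star t) G ≤ n * D ^ t
emb-star-≤ t {n} G D deg≤D = begin
    emb (star t) G      ≡⟨ emb-star≡sum-starsAt t G ⟩
    sum (starsAt t G)   ≤⟨ sum-≤-* (D ^ t) (λ c → ≤-trans (starsAt-≤ t G c) (^-monoˡ-≤ t (deg≤D c))) ⟩
    n * D ^ t           ∎
  where open ≤-Reasoning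

degree-≤ : ∀ {k n} (F : Graph k) → 1 ≤ emb F (star k) → (G : Graph n) → emb F G ≡ 0 →
  ∀ v → card (adj G v) ≤ k
degree-≤ {k} F F⊆star G F↛G v with card (adj G v) ≤? k
... | yes deg≤k = deg≤k
... | no  deg≰k =
  let _ , E = emb-positive⇒Embedding F (star k) F⊆star
      _ , S = high-degree⇒star k G v (≰⇒> deg≰k)
  in  ⊥-elim (emb≡0⇒¬Embedding F↛G _ (∘-Embedding E S))

progression-≤-sum : ∀ T o q {n} (f : Fin n → ℕ) → o + q * suc T ≤ n →
  (∀ c b → toℕ c ≡ o + b * suc T → b < q → 1 ≤ f c) → q ≤ sum f
progression-≤-sum T o       zero    f _ _ = z≤n
progression-≤-sum T zero    (suc q) {suc n} f (s≤s fits) pos =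
  +-mono-≤ (pos zero 0 refl (s≤s z≤n))
           (progression-≤-sum T T q (f ∘ suc) fits λ c b e b<q → pos (suc c) (suc b) (cong suc e) (s≤s b<q))
progression-≤-sum T (suc o) (suc q) {suc n} f (s≤s fits) pos =
  ≤-trans (progression-≤-sum T o (suc q) (f ∘ suc) fits λ c b e → pos (suc c) b (cong suc e))
          (m≤n+m _ (f zero))

module _ (t : ℕ) {n : ℕ} where

  blockVertex : ∀ b → suc b * suc t ≤ n → Fin (suc t) → Fin n
  blockVertex b fits j = fromℕ< (≤-trans (+-monoˡ-≤ (b * suc t) (toℕ<n j)) fits)

  toℕ-blockVertex : ∀ b fits j → toℕ (blockVertex b fits j) ≡ toℕ j + b * suc t
  toℕ-blockVertex b fits j = toℕ-fromℕ< _

  block-Embedding : ∀ b fits → Embedding (star t) (starForest t n) (Data.Vec.tabulate (blockVertex b fits))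
  block-Embedding b fits = record
    { injective = λ i j e → toℕ-injective (+-cancelʳ-≡ _ _ _ (trans (≡.sym (position i))
                    (trans (cong toℕ e) (position j))))
    ; adjacent  = λ i j a → subst₂ (λ x y → forestRel t x y ≡ true) (≡.sym (position i)) (≡.sym (position j))
                    (trans (forestRel-block t b (toℕ<n i) (toℕ<n j)) (trans (≡.sym (star-realises t i j)) a))
    }
    where
    position : ∀ j → toℕ (lookup (Data.Vec.tabulate (blockVertex b fits)) j) ≡ toℕ j + b * suc t
    position j = trans (cong toℕ (lookup∘tabulate (blockVertex b fits) j)) (toℕ-blockVertex b fits j)

  emb-star-forest-≥ : n / suc t ≤ emb (star t) (starForest t n)
  emb-star-forest-≥ = begin
      n / suc t                      ≤⟨ progression-≤-sum t 0 (n / suc t) (starsAt t F) (m/n*n≤m n (suc t)) centre ⟩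
      sum (starsAt t F)              ≡⟨ emb-star≡sum-starsAt t F ⟨
      emb (star t) F                 ∎
    where
    open ≤-Reasoning
    F = starForest t n
    centre : ∀ c b → toℕ c ≡ b * suc t → b < n / suc t → 1 ≤ starsAt t F c
    centre c b c≡bT b<q = count-positive (λ w → isEmbedding (star t) F (c ∷ w)) leaves
        (subst (λ x → isEmbedding (star t) F (x ∷ leaves) ≡ true) (≡.sym c≡centre)
          (Embedding⇒isEmbedding (star t) F _ (block-Embedding b fits)))
      where
      fits : suc b * suc t ≤ n
      fits = ≤-trans (*-monoˡ-≤ (suc t) b<q) (m/n*n≤m n (suc t))
      c≡centre : c ≡ blockVertex b fits zero
      c≡centre = toℕ-injective (trans c≡bT (≡.sym (toℕ-blockVertex b fits zero)))
      leaves = Data.Vec.tabulate (blockVertex b fits ∘ suc)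

-- Greedy packing of stars

allᵥ⁻ : ∀ {k n} (p : Fin n → Bool) (w : Vec (Fin n) k) → allᵥ p w ≡ true → ∀ j → p (lookup w j) ≡ true
allᵥ⁻ p (x ∷ w) h zero    = proj₁ (∧-true h)
allᵥ⁻ p (x ∷ w) h (suc j) = allᵥ⁻ p w (proj₂ (∧-true h)) j

allᵥ-false : ∀ {k n} (p : Fin n → Bool) (w : Vec (Fin n) k) → allᵥ p w ≡ false → ∃ λ j → p (lookup w j) ≡ false
allᵥ-false p (x ∷ w) h with p x in px
... | false = zero , px
... | true  = let j , q = allᵥ-false p w h in suc j , q

allᵥ-∧ : ∀ {k n} (p q : Fin n → Bool) (w : Vec (Fin n) k) → allᵥ (λ x → p x ∧ q x) w ≡ allᵥ p w ∧ allᵥ q w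
allᵥ-∧ p q []      = refl
allᵥ-∧ p q (x ∷ w) with p x | q x
... | true  | true  = allᵥ-∧ p q w
... | true  | false = ≡.sym (∧-zeroʳ (allᵥ p w))
... | false | _     = refl

anyᵥ : ∀ {k n} → (Fin n → Bool) → Vec (Fin n) k → Bool
anyᵥ p []      = false
anyᵥ p (x ∷ w) = p x ∨ anyᵥ p w

anyᵥ⁺ : ∀ {k n} (p : Fin n → Bool) (w : Vec (Fin n) k) j → p (lookup w j) ≡ true → anyᵥ p w ≡ true
anyᵥ⁺ p (x ∷ w) zero    h rewrite h = refl
anyᵥ⁺ p (x ∷ w) (suc j) h rewrite anyᵥ⁺ p w j h = ∨-zeroʳ (p x)

outside : ∀ {k n} → Vec (Fin n) k → Fin n → Bool
outside f x = allᵥ (λ y → not (eqᶠ x y)) f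

outside⁻ : ∀ {k n} (f : Vec (Fin n) k) {x} → outside f x ≡ true → ∀ i → x ≢ lookup f i
outside⁻ f h i refl with () ← trans (≡.sym (cong not (eqᶠ-refl (lookup f i)))) (allᵥ⁻ _ f h i)

outside-false : ∀ {k n} (f : Vec (Fin n) k) {x} → outside f x ≡ false → ∃ λ i → x ≡ lookup f i
outside-false f h = let i , q = allᵥ-false _ f h in i , eqᶠ⇒≡ (trans (≡.sym (not-involutive _)) (cong not q))

module Packing (t : ℕ) {n : ℕ} (G : Graph n) (D : ℕ) (deg≤D : ∀ v → card (adj G v) ≤ D) where

  near : ∀ {k} → Vec (Fin n) k → Fin n → Bool
  near f c = anyᵥ (λ y → eqᶠ c y ∨ adj G y c) f

  card-near : ∀ {k} (f : Vec (Fin n) k) → card (near f) ≤ k * suc D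
  card-near []      = ≤-reflexive (sum-replicate-zero n)
  card-near (y ∷ f) = ≤-trans (card-∨ _ (near f))
    (+-mono-≤ (≤-trans (card-∨ (λ c → eqᶠ c y) (adj G y)) (+-mono-≤ (≤-reflexive (card-single y)) (deg≤D y)))
              (card-near f))

  -- every vertex of a star is its centre or a neighbour of it
  meets⇒near-centre : ∀ {k} (f : Vec (Fin n) k) c w → Embedding (star t) G (c ∷ w) →
    allᵥ (outside f) (c ∷ w) ≡ false → near f c ≡ true
  meets⇒near-centre f c w E meets with allᵥ-false (outside f) (c ∷ w) meets
  ... | zero  , c∈f = let i , c≡fᵢ = outside-false f c∈f in
    anyᵥ⁺ _ f i (subst (λ y → (eqᶠ c y ∨ adj G y c) ≡ true) c≡fᵢ (cong (_∨ adj G c c) (eqᶠ-refl c)))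
  ... | suc j , wⱼ∈f = let i , wⱼ≡fᵢ = outside-false f wⱼ∈f in
    anyᵥ⁺ _ f i (subst (λ y → (eqᶠ c y ∨ adj G y c) ≡ true) wⱼ≡fᵢ
      (trans (cong (_ ∨_) (trans (sym G _ c) (adjacent E zero (suc j) refl))) (∨-zeroʳ _)))

  stars : (Fin n → Bool) → ℕ
  stars A = count λ v → isEmbedding (star t) G v ∧ allᵥ A v

  starsMeeting : ∀ {k} → Vec (Fin n) k → ℕ
  starsMeeting f = count λ v → isEmbedding (star t) G v ∧ not (allᵥ (outside f) v)

  starsMeeting-≤ : (f : Vec (Fin n) (suc t)) → starsMeeting f ≤ suc t * suc D * D ^ t
  starsMeeting-≤ f = begin
      starsMeeting f                                  ≤⟨ sum-mono-≤ (λ c → count-mono (λ w → centreNear c w)) ⟩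
      sum (λ c → count (λ w → near f c ∧ isEmbedding (star t) G (c ∷ w)))
                                                      ≡⟨ sum-cong-≗ {n} (λ c → count-const-∧ {t} (near f c)
                                                           (λ w → isEmbedding (star t) G (c ∷ w))) ⟩
      sum (λ c → χ (near f c) * starsAt t G c)        ≤⟨ sum-mono-≤ (λ c → *-monoʳ-≤ (χ (near f c))
                                                           (≤-trans (starsAt-≤ t G c) (^-monoˡ-≤ t (deg≤D c)))) ⟩
      sum (λ c → χ (near f c) * D ^ t)                ≡⟨ *-distribʳ-sum (D ^ t) (χ ∘ near f) ⟨
      card (near f) * D ^ t                           ≤⟨ *-monoˡ-≤ (D ^ t) (card-near f) ⟩
      suc t * suc D * D ^ t                           ∎
    where
    open ≤-Reasoning
    centreNear : ∀ c w → (isEmbedding (star t) G (c ∷ w) ∧ not (allᵥ (outside f) (c ∷ w))) ≡ true →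
      (near f c ∧ isEmbedding (star t) G (c ∷ w)) ≡ true
    centreNear c w h with ∧-true h
    ... | isEmb , meets = cong₂ _∧_
      (meets⇒near-centre f c w (isEmbedding⇒Embedding (star t) G (c ∷ w) isEmb)
        (trans (≡.sym (not-involutive (allᵥ (outside f) (c ∷ w)))) (cong not meets)))
      isEmb

  record Pack (m : ℕ) (A : Fin n → Bool) : Set where
    field
      copy     : Fin m → Vec (Fin n) (suc t)
      embeds   : ∀ b → Embedding (star t) G (copy b)
      inside   : ∀ b x → A (lookup (copy b) x) ≡ true
      disjoint : ∀ b b′ x x′ → lookup (copy b) x ≡ lookup (copy b′) x′ → b ≡ b′
  open Pack

  Pack-extend : ∀ {m A} f → Embedding (star t) G f → (∀ x → A (lookup f x) ≡ true) →
    Pack m (λ x → A x ∧ outside f x) → Pack (suc m) A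
  Pack-extend {A = A} f E f⊆A P =
    record { copy = copy′ ; embeds = embeds′ ; inside = inside′ ; disjoint = disjoint′ }
    where
    copy′ : Fin (suc _) → Vec (Fin n) (suc t)
    copy′ zero    = f
    copy′ (suc b) = copy P b
    embeds′ : ∀ b → Embedding (star t) G (copy′ b)
    embeds′ zero    = E
    embeds′ (suc b) = embeds P b
    inside′ : ∀ b x → A (lookup (copy′ b) x) ≡ true
    inside′ zero    x = f⊆A x
    inside′ (suc b) x = proj₁ (∧-true (inside P b x))
    outsideᶠ : ∀ b x → outside f (lookup (copy P b) x) ≡ true
    outsideᶠ b x = proj₂ (∧-true (inside P b x))
    disjoint′ : ∀ b b′ x x′ → lookup (copy′ b) x ≡ lookup (copy′ b′) x′ → b ≡ b′
    disjoint′ zero    zero     _ _  _ = refl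
    disjoint′ zero    (suc b′) x x′ e = ⊥-elim (outside⁻ f (outsideᶠ b′ x′) x (≡.sym e))
    disjoint′ (suc b) zero     x x′ e = ⊥-elim (outside⁻ f (outsideᶠ b x) x′ e)
    disjoint′ (suc b) (suc b′) x x′ e = cong suc (disjoint P b b′ x x′ e)

  stars-split : ∀ A (f : Vec (Fin n) (suc t)) → stars A ≤ stars (λ x → A x ∧ outside f x) + starsMeeting f
  stars-split A f = ≤-trans (count-mono split)
    (count-∨ (λ v → isEmbedding (star t) G v ∧ allᵥ (λ x → A x ∧ outside f x) v)
             (λ v → isEmbedding (star t) G v ∧ not (allᵥ (outside f) v)))
    where
    split : ∀ v → (isEmbedding (star t) G v ∧ allᵥ A v) ≡ true →
      ((isEmbedding (star t) G v ∧ allᵥ (λ x → A x ∧ outside f x) v)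
       ∨ (isEmbedding (star t) G v ∧ not (allᵥ (outside f) v))) ≡ true
    split v h rewrite allᵥ-∧ A (outside f) v
      with isEmbedding (star t) G v | allᵥ A v | allᵥ (outside f) v
    ... | true | true | true  = refl
    ... | true | true | false = refl

  ¬Pack⇒stars-≤ : ∀ m A → ¬ Pack m A → stars A ≤ m * (suc t * suc D * D ^ t)
  ¬Pack⇒stars-≤ zero    A ¬P =
    ⊥-elim (¬P (record { copy = λ () ; embeds = λ () ; inside = λ () ; disjoint = λ () }))
  ¬Pack⇒stars-≤ (suc m) A ¬P with stars A ≟ 0
  ... | yes none = subst (_≤ _) (≡.sym none) z≤n
  ... | no  some = begin
      stars A                                      ≤⟨ stars-split A f ⟩
      stars A∖f + starsMeeting f                   ≤⟨ +-mono-≤ (¬Pack⇒stars-≤ m A∖f (¬P ∘ Pack-extend f E f⊆A))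
                                                               (starsMeeting-≤ f) ⟩
      m * cc + cc                                  ≡⟨ +-comm (m * cc) cc ⟩
      suc m * cc                                   ∎
    where
    open ≤-Reasoning
    cc = suc t * suc D * D ^ t
    witness = count-witness (λ v → isEmbedding (star t) G v ∧ allᵥ A v) (n≢0⇒n>0 some)
    f = proj₁ witness
    f-ok = ∧-true {isEmbedding (star t) G f} (proj₂ witness)
    E = isEmbedding⇒Embedding (star t) G f (proj₁ f-ok)
    f⊆A = allᵥ⁻ A f (proj₂ f-ok)
    A∖f = λ x → A x ∧ outside f x

  Pack⇒forest-Embedding : ∀ {m A} (P : Pack m A) → ∃ (Embedding (starForest t (m * suc t)) G)
  Pack⇒forest-Embedding {m} P = Data.Vec.tabulate vertex , record { injective = inj ; adjacent = adjc }
    where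
    T = suc t
    block : Fin (m * T) → Fin m
    block a = fromℕ< (m<n*o⇒m/o<n {n = m} (toℕ<n a))
    pos : Fin (m * T) → Fin T
    pos a = fromℕ< (m%n<n (toℕ a) T)
    toℕ-block : ∀ a → toℕ (block a) ≡ toℕ a / T
    toℕ-block a = toℕ-fromℕ< _
    toℕ-pos : ∀ a → toℕ (pos a) ≡ toℕ a % T
    toℕ-pos a = toℕ-fromℕ< _
    vertex : Fin (m * T) → Fin n
    vertex a = lookup (copy P (block a)) (pos a)
    lookup-vertex : ∀ a → lookup (Data.Vec.tabulate vertex) a ≡ vertex a
    lookup-vertex = lookup∘tabulate vertex
    sameCopy : ∀ {b b′} x x′ → b ≡ b′ → lookup (copy P b) x ≡ lookup (copy P b′) x′ → x ≡ x′
    sameCopy {b} x x′ refl = injective (embeds P b) x x′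
    inj : ∀ a a′ → lookup (Data.Vec.tabulate vertex) a ≡ lookup (Data.Vec.tabulate vertex) a′ → a ≡ a′
    inj a a′ e = toℕ-injective (begin
        toℕ a                          ≡⟨ m≡m%n+[m/n]*n (toℕ a) T ⟩
        toℕ a % T + (toℕ a / T) * T    ≡⟨ cong₂ (λ r q → r + q * T) same% same/ ⟩
        toℕ a′ % T + (toℕ a′ / T) * T  ≡⟨ m≡m%n+[m/n]*n (toℕ a′) T ⟨
        toℕ a′                         ∎)
      where
      open ≡-Reasoning
      e′ = trans (≡.sym (lookup-vertex a)) (trans e (lookup-vertex a′))
      sameBlock = disjoint P (block a) (block a′) (pos a) (pos a′) e′
      same/ = trans (≡.sym (toℕ-block a)) (trans (cong toℕ sameBlock) (toℕ-block a′))
      same% = trans (≡.sym (toℕ-pos a))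
                    (trans (cong toℕ (sameCopy (pos a) (pos a′) sameBlock e′)) (toℕ-pos a′))
    adjc : ∀ a a′ → forestRel t (toℕ a) (toℕ a′) ≡ true →
      adj G (lookup (Data.Vec.tabulate vertex) a) (lookup (Data.Vec.tabulate vertex) a′) ≡ true
    adjc a a′ h rewrite lookup-vertex a | lookup-vertex a′ = adjacentInCopy (pos a) (pos a′) sameBlock adjacentPos
      where
      sameBlock : block a ≡ block a′
      sameBlock = toℕ-injective (trans (toℕ-block a)
                                       (trans (⌊⌋⇒ (_ ≟ _) (proj₁ (∧-true h))) (≡.sym (toℕ-block a′))))
      adjacentPos : adj (star t) (pos a) (pos a′) ≡ true
      adjacentPos = trans (star-realises t (pos a) (pos a′))
                          (trans (cong₂ starRel (toℕ-pos a) (toℕ-pos a′)) (proj₂ (∧-true h)))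
      adjacentInCopy : ∀ {b b′} x x′ → b ≡ b′ → adj (star t) x x′ ≡ true →
        adj G (lookup (copy P b) x) (lookup (copy P b′) x′) ≡ true
      adjacentInCopy {b} x x′ refl = adjacent (embeds P b) x x′

  -- m disjoint stars in G would carry a copy of F
  emb-star-≤-¬forest : ∀ {k} (F : Graph k) m → 1 ≤ emb F (starForest t (m * suc t)) → emb F G ≡ 0 →
    emb (star t) G ≤ m * (suc t * suc D * D ^ t)
  emb-star-≤-¬forest F m F⊆forest F↛G = begin
      emb (star t) G                  ≡⟨ emb≡count (star t) G ⟩
      count (isEmbedding (star t) G)  ≡⟨ count-cong (λ v → ≡.sym (trans (cong (isEmbedding (star t) G v ∧_)
                                           (allᵥ⁺ (λ _ → true) v λ _ → refl)) (∧-identityʳ _))) ⟩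
      stars (λ _ → true)              ≤⟨ ¬Pack⇒stars-≤ m (λ _ → true) ¬Pack ⟩
      m * (suc t * suc D * D ^ t)     ∎
    where
    open ≤-Reasoning
    ¬Pack : ¬ Pack m (λ _ → true)
    ¬Pack P = let _ , E = emb-positive⇒Embedding F (starForest t (m * suc t)) F⊆forest
                  _ , S = Pack⇒forest-Embedding P
              in  emb≡0⇒¬Embedding F↛G _ (∘-Embedding E S)

-- The three regimes

zero-on-all-or-positive : {A : Set} (g : A → ℕ) (xs : List A) →
  (∀ {x} → x ∈ xs → g x ≡ 0) ⊎ (∃ λ x → x ∈ xs × 1 ≤ g x)
zero-on-all-or-positive g xs with All.all? (λ x → g x ≟ 0) xs
... | yes all-zero = inj₁ (All.lookup all-zero)
... | no  ¬all-zero =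
  let x , x∈xs , gx≢0 = find (¬All⇒Any¬ (λ x → g x ≟ 0) xs ¬all-zero) in inj₂ (x , x∈xs , n≢0⇒n>0 gx≢0)

module _ (t : ℕ) (𝓕 : Family) where

  ExOmegaPow-star : 1 ≤ t → (∀ {F} → F ∈ 𝓕 → emb (proj₂ F) (star (proj₁ F)) ≡ 0) →
    ExOmegaPow (star t) 𝓕 t
  ExOmegaPow-star 1≤t 𝓕↛stars = suc (t + (t + A)) , 2 ^ t * (2 * A) , host
    where
    A = emb (star t) (star t)
    host : ∀ n → suc (t + (t + A)) ≤ n → ExAtLeastScaled (star t) 𝓕 n (2 ^ t * (2 * A)) (n ^ t)
    host (suc m) (s≤s m≥) = star m , free , bound
      where
      free : Free 𝓕 (star m)
      free {k , F} F∈𝓕 = Embedding-transfers-emb≡0 F (star m) (star k) (relabel-star F) (𝓕↛stars F∈𝓕)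
      s = m ∸ t
      s≥t+A : t + A ≤ s
      s≥t+A = subst (_≤ s) (m+n∸m≡n t (t + A)) (∸-monoˡ-≤ t m≥)
      1≤A = emb-self-positive (star t)
      A≤s = ≤-trans (m≤n+m A t) s≥t+A
      A≤sᵗ = ≤-trans A≤s (m≤m^n s t (≤-trans 1≤A A≤s) 1≤t)
      1+t≤s = ≤-trans (≤-trans (≤-reflexive (+-comm 1 t)) (+-monoʳ-≤ t 1≤A)) s≥t+A
      c = copies (star t) (star m)
      bound : suc m ^ t ≤ 2 ^ t * (2 * A) * c
      bound = begin
          suc m ^ t              ≡⟨ cong (λ x → suc x ^ t) (m+[n∸m]≡n (≤-trans (m≤m+n t _) m≥)) ⟨
          suc (t + s) ^ t        ≤⟨ ^-monoˡ-≤ t (+-monoˡ-≤ s 1+t≤s) ⟩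
          (s + s) ^ t            ≡⟨ cong (λ x → (s + x) ^ t) (+-identityʳ s) ⟨
          (2 * s) ^ t            ≡⟨ ^-distribʳ-* 2 s t ⟩
          2 ^ t * s ^ t          ≤⟨ *-monoʳ-≤ (2 ^ t)
                                      (≤-2*|Aut|*copies (star t) (star m) (s ^ t) A≤sᵗ (emb-star-star-≥ t m)) ⟩
          2 ^ t * (2 * A * c)    ≡⟨ *-assoc (2 ^ t) (2 * A) c ⟨
          2 ^ t * (2 * A) * c    ∎
        where open ≤-Reasoning

  ExLinear-star : ∀ {k₀} {F₀ : Graph k₀} → (k₀ , F₀) ∈ 𝓕 → 1 ≤ emb F₀ (star k₀) →
    (∀ {F} → F ∈ 𝓕 → emb (proj₂ F) (starForest t (proj₁ F * suc t)) ≡ 0) → ExLinear (star t) 𝓕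
  ExLinear-star {k₀} {F₀} F₀∈𝓕 F₀⊆star 𝓕↛forests =
    A * suc t , k₀ ^ t , 2 * suc t * (2 * A) , λ n n≥ → lower n n≥ , upper n
    where
    A = emb (star t) (star t)
    lower : ∀ n → A * suc t ≤ n → ExAtLeastScaled (star t) 𝓕 n (2 * suc t * (2 * A)) n
    lower n n≥ = starForest t n , free , (begin
        n                                        ≤⟨ m≤2*[m/n]*n n (suc t) T≤n ⟩
        2 * (n / suc t * suc t)                  ≤⟨ *-monoʳ-≤ 2 (*-monoˡ-≤ (suc t) n/T≤2Ac) ⟩
        2 * (2 * A * c * suc t)                  ≡⟨ reorder (suc t) A c ⟩
        2 * suc t * (2 * A) * c                  ∎)
      where
      open ≤-Reasoning
      c = copies (star t) (starForest t n)
      reorder : ∀ T A c → 2 * (2 * A * c * T) ≡ 2 * T * (2 * A) * c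
      reorder = solve-∀
      free : Free 𝓕 (starForest t n)
      free {k , F} F∈𝓕 =
        Embedding-transfers-emb≡0 F (starForest t n) (starForest t (k * suc t)) (relabel-forest t F) (𝓕↛forests F∈𝓕)
      A≤n/T : A ≤ n / suc t
      A≤n/T = subst (_≤ n / suc t) (m*n/n≡m A (suc t)) (/-monoˡ-≤ (suc t) n≥)
      n/T≤2Ac : n / suc t ≤ 2 * A * c
      n/T≤2Ac = ≤-2*|Aut|*copies (star t) (starForest t n) (n / suc t) A≤n/T (emb-star-forest-≥ t {n})
      T≤n : suc t ≤ n
      T≤n = ≤-trans (m≤n*m (suc t) A {{>-nonZero (emb-self-positive (star t))}}) n≥
    upper : ∀ n → ExAtMost (star t) 𝓕 n (k₀ ^ t * n)
    upper n G G-free = begin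
        copies (star t) G   ≤⟨ copies-≤-emb (star t) G ⟩
        emb (star t) G      ≤⟨ emb-star-≤ t G k₀ (degree-≤ F₀ F₀⊆star G (G-free F₀∈𝓕)) ⟩
        n * k₀ ^ t          ≡⟨ *-comm n (k₀ ^ t) ⟩
        k₀ ^ t * n          ∎
      where open ≤-Reasoning

  ExBounded-star : ∀ {k₀ k₁} {F₀ : Graph k₀} {F₁ : Graph k₁} →
    (k₀ , F₀) ∈ 𝓕 → 1 ≤ emb F₀ (star k₀) →
    (k₁ , F₁) ∈ 𝓕 → 1 ≤ emb F₁ (starForest t (k₁ * suc t)) → ExBounded (star t) 𝓕
  ExBounded-star {k₀} {k₁} {F₀} {F₁} F₀∈𝓕 F₀⊆star F₁∈𝓕 F₁⊆forest =
    0 , k₁ * (suc t * suc k₀ * k₀ ^ t) , λ n _ G G-free →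
      ≤-trans (copies-≤-emb (star t) G)
              (Packing.emb-star-≤-¬forest t G k₀ (degree-≤ F₀ F₀⊆star G (G-free F₀∈𝓕))
                                          F₁ k₁ F₁⊆forest (G-free F₁∈𝓕))

lemma2p1 : (t : ℕ) → 1 ≤ t → (𝓕 : Family) →
    ExBounded (star t) 𝓕 ⊎ ExLinear (star t) 𝓕 ⊎ ExOmegaPow (star t) 𝓕 t
lemma2p1 t 1≤t 𝓕 with zero-on-all-or-positive (λ (k , F) → emb F (star k)) 𝓕
... | inj₁ 𝓕↛stars = inj₂ (inj₂ (ExOmegaPow-star t 𝓕 1≤t 𝓕↛stars))
... | inj₂ (_ , F₀∈𝓕 , F₀⊆star)
  with zero-on-all-or-positive (λ (k , F) → emb F (starForest t (k * suc t))) 𝓕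
...   | inj₁ 𝓕↛forests = inj₂ (inj₁ (ExLinear-star t 𝓕 F₀∈𝓕 F₀⊆star 𝓕↛forests))
...   | inj₂ (_ , F₁∈𝓕 , F₁⊆forest) = inj₁ (ExBounded-star t 𝓕 F₀∈𝓕 F₀⊆star F₁∈𝓕 F₁⊆forest)
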